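{- Let $S\subseteq \mathbb{N}^d$ be a generalized numerical semigroup of genus $g$. Then $S$ is pseudo-symmetric if and only if there exists $\mathbf{f}\in H(S)$ with $2g-1=(f^{(1)}+1)(f^{(2)}+1)\cdots(f^{(d)}+1)$. Furthermore, such an $\mathbf{f}$ is the Frobenius element of $S$, i.e. the unique maximal element of $H(S)$ with respect to the componentwise partial order on $\mathbb{N}^d$.
   Context: A generalized numerical semigroup (GNS) is a submonoid $S\subseteq\mathbb{N}^d$ such that $H(S)=\mathbb{N}^d\setminus S$ is finite; its genus is $g=|H(S)|$. For $\mathbf{x}\in\mathbb{N}^d$, $x^{(i)}$ is its $i$-th component. $PF(S)=\{\mathbf{x}\in H(S)\mid \mathbf{x}+\mathbf{s}\in S \text{ for all } \mathbf{s}\in S\setminus\{\mathbf{0}\}\}$. $S$ is pseudo-symmetric if there exists $\mathbf{f}\in\mathbb{N}^d$ with all components even such that $PF(S)=\{\mathbf{f},\frac{\mathbf{f}}{2}\}$ (equivalently, there exists $\mathbf{f}\in H(S)$ with all components even such that $\mathbf{f}-\mathbf{h}\in S$ for all $\mathbf{h}\in H(S)$, $\mathbf{h}\ne \frac{\mathbf{f}}{2}$). The componentwise order: $\mathbf{x}\le\mathbf{y}$ iff $x^{(i)}\le y^{(i)}$ for all $i$. -}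

module Defs where

open import Level using (0ℓ)
open import Data.Nat using (ℕ; zero; suc; _+_; _*_; _≤_)
open import Data.Vec using (Vec; []; _∷_; replicate; zipWith; map; foldr)
open import Data.Vec.Relation.Binary.Pointwise.Inductive using (Pointwise)
open import Data.List using (List; length)
open import Data.List.Membership.Propositional using (_∈_)
open import Data.List.Relation.Unary.Unique.Propositional using (Unique)
open import Data.Product using (Σ; ∃; _×_)
open import Data.Sum using (_⊎_)
open import Function.Bundles using (_⇔_)
open import Relation.Nullary using (¬_)
open import Relation.Unary using (Pred)
open import Relation.Binary.PropositionalEquality using (_≡_; _≢_)

Pt : ℕ → Set
Pt d = Vec ℕ d

𝟎 : ∀ {d} → Pt d
𝟎 {d} = replicate d 0

_⊕_ : ∀ {d} → Pt d → Pt d → Pt d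
_⊕_ = zipWith _+_

_≼_ : ∀ {d} → Pt d → Pt d → Set
_≼_ = Pointwise _≤_

-- componentwise doubling (f = 2·h  ⇔  f has all components even, h = f/2)
double : ∀ {d} → Pt d → Pt d
double = map (2 *_)

prodV : ∀ {d} → Pt d → ℕ
prodV = foldr _ _*_ 1

prodSuc : ∀ {d} → Pt d → ℕ
prodSuc f = prodV (map suc f)

H : ∀ {d} → Pred (Pt d) 0ℓ → Pt d → Set
H S x = ¬ S x

IsSubmonoid : ∀ {d} → Pred (Pt d) 0ℓ → Set
IsSubmonoid S = S 𝟎 × (∀ x y → S x → S y → S (x ⊕ y))

EnumeratesHoles : ∀ {d} → Pred (Pt d) 0ℓ → List (Pt d) → Set
EnumeratesHoles S hs =
  Unique hs × (∀ x → S x ⊎ x ∈ hs) × (∀ x → x ∈ hs → ¬ S x)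

-- S is a generalized numerical semigroup: a submonoid of ℕ^d with finite complement
IsGNS : ∀ {d} → Pred (Pt d) 0ℓ → Set
IsGNS S = IsSubmonoid S × Σ (List _) (EnumeratesHoles S)

HasGenus : ∀ {d} → Pred (Pt d) 0ℓ → ℕ → Set
HasGenus S g = Σ (List _) λ hs → EnumeratesHoles S hs × length hs ≡ g

PF : ∀ {d} → Pred (Pt d) 0ℓ → Pt d → Set
PF S x = H S x × (∀ s → S s → s ≢ 𝟎 → S (x ⊕ s))

-- S is pseudo-symmetric: PF(S) = {f, f/2} for some f with all components even
-- (written f = double h, so f/2 = h)
IsPseudoSymmetric : ∀ {d} → Pred (Pt d) 0ℓ → Set
IsPseudoSymmetric {d} S =
  ∃ λ (h : Pt d) → ∀ x → PF S x ⇔ (x ≡ double h ⊎ x ≡ h)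

IsMaximalHole : ∀ {d} → Pred (Pt d) 0ℓ → Pt d → Set
IsMaximalHole S f = H S f × (∀ h → H S h → f ≼ h → h ≡ f)

IsFrobenius : ∀ {d} → Pred (Pt d) 0ℓ → Pt d → Set
IsFrobenius S f = IsMaximalHole S f × (∀ f′ → IsMaximalHole S f′ → f′ ≡ f)

module Submission where

-- For a point f let B(f) = {x ∣ x ≼ f}, a box with ∏ᵢ (f⁽ⁱ⁾ + 1) points,
-- and consider the involution x ↦ f − x of B(f).  Summing, over x ∈ B(f), the
-- number of holes among x and f − x counts every hole of B(f) twice.
--  * If f = 2h is a hole, then x and f − x are never both in S, and h = f − h is a
--    hole; so 1 + ∏ᵢ (f⁽ⁱ⁾ + 1) ≤ 2·|H(S) ∩ B(f)| ≤ 2g, with equality iff every hole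
--    lies in B(f) and f − x ∈ S for every hole x ≠ h ("the holes reflect about h").
--  * If 2g − 1 = ∏ᵢ (f⁽ⁱ⁾ + 1), the product is odd, so f = 2h, and we are in the
--    equality case.  Conversely, if PF(S) = {2h, h}, climbing from any hole to a
--    pseudo-Frobenius element shows that the holes reflect about h.
--  * Holes reflecting about h (with 2h a hole) give PF(S) = {2h, h} directly, and
--    make 2h the largest hole, hence the Frobenius element.

open import Defs
open import Level using (0ℓ)
open import Data.Nat using (ℕ; zero; suc; _+_; _*_; _∸_; _≤_; _<_; z≤n; s≤s; _≤?_; ⌊_/2⌋; parity)
open import Data.Nat.Properties
open import Data.Nat.Induction using (<-wellFounded)
open import Algebra.Properties.CommutativeSemigroup +-commutativeSemigroup using (interchange)
open import Data.Parity.Base as ℙ using (0ℙ; 1ℙ; _⁻¹)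
open import Data.Parity.Properties using (suc-homo-⁻¹; *-homo-*)
open import Data.Product using (∃; _×_; _,_; proj₁; proj₂)
open import Data.Sum using (_⊎_; inj₁; inj₂)
open import Data.Empty using (⊥-elim)
open import Data.Vec using ([]; _∷_; map; zipWith)
import Data.Vec as Vec
open import Data.Vec.Properties using (zipWith-assoc; zipWith-comm; zipWith-identityʳ; ≡-dec; ∷-injectiveˡ; ∷-injectiveʳ)
import Data.Vec.Relation.Binary.Pointwise.Inductive as Pointwise
open Pointwise using ([]; _∷_)
open import Data.List using (List; []; _∷_; length; filter)
import Data.List as List
open import Data.Nat.ListAction using (sum)
open import Data.List.Properties using (length-filter; filter-all; filter-notAll)
open import Data.List.Relation.Unary.Any using (Any; here; there; any?)
open import Data.List.Relation.Unary.All using (tabulate)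
open import Data.List.Relation.Unary.All.Properties using (All¬⇒¬Any)
open import Data.List.Relation.Unary.AllPairs using (_∷_)
open import Data.List.Relation.Unary.Unique.Propositional using (Unique)
open import Data.List.Membership.Propositional using (_∈_; _∉_; find; lose)
open import Function.Bundles using (_⇔_; mk⇔; Equivalence)
open import Induction.WellFounded using (Acc; acc)
open import Relation.Nullary using (¬_; Dec; yes; no)
open import Relation.Nullary.Decidable using (_×-dec_; ¬?; decidable-stable)
open import Relation.Unary using (Pred)
open import Relation.Binary.PropositionalEquality using (_≡_; _≢_; refl; sym; trans; cong; cong₂; subst; subst₂; module ≡-Reasoning)

-- Componentwise truncated subtraction: y ⊖ x is y − x whenever x ≼ y.
_⊖_ : ∀ {d} → Pt d → Pt d → Pt d
_⊖_ = zipWith _∸_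

_≟ₚ_ : ∀ {d} (x y : Pt d) → Dec (x ≡ y)
_≟ₚ_ = ≡-dec Data.Nat._≟_

_≼?_ : ∀ {d} (x y : Pt d) → Dec (x ≼ y)
_≼?_ = Pointwise.decidable _≤?_

≼-refl : ∀ {d} {x : Pt d} → x ≼ x
≼-refl = Pointwise.refl ≤-refl

≼-trans : ∀ {d} {x y z : Pt d} → x ≼ y → y ≼ z → x ≼ z
≼-trans = Pointwise.trans ≤-trans

≼-antisym : ∀ {d} {x y : Pt d} → x ≼ y → y ≼ x → x ≡ y
≼-antisym []       []       = refl
≼-antisym (p ∷ ps) (q ∷ qs) = cong₂ _∷_ (≤-antisym p q) (≼-antisym ps qs)

⊕-comm : ∀ {d} (x y : Pt d) → x ⊕ y ≡ y ⊕ x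
⊕-comm = zipWith-comm +-comm

⊕-assoc : ∀ {d} (x y z : Pt d) → (x ⊕ y) ⊕ z ≡ x ⊕ (y ⊕ z)
⊕-assoc = zipWith-assoc +-assoc

⊕-identityʳ : ∀ {d} (x : Pt d) → x ⊕ 𝟎 ≡ x
⊕-identityʳ = zipWith-identityʳ +-identityʳ

⊕-self : ∀ {d} (x : Pt d) → x ⊕ x ≡ double x
⊕-self []      = refl
⊕-self (a ∷ x) = cong₂ _∷_ (cong (a +_) (sym (+-identityʳ a))) (⊕-self x)

x≼x⊕y : ∀ {d} (x y : Pt d) → x ≼ (x ⊕ y)
x≼x⊕y []      []      = []
x≼x⊕y (a ∷ x) (b ∷ y) = m≤m+n a b ∷ x≼x⊕y x y

⊕-⊖-cancel : ∀ {d} {x y : Pt d} → x ≼ y → x ⊕ (y ⊖ x) ≡ y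
⊕-⊖-cancel []       = refl
⊕-⊖-cancel (p ∷ ps) = cong₂ _∷_ (m+[n∸m]≡n p) (⊕-⊖-cancel ps)

⊕-⊖-cancelˡ : ∀ {d} (x y : Pt d) → (x ⊕ y) ⊖ x ≡ y
⊕-⊖-cancelˡ []      []      = refl
⊕-⊖-cancelˡ (a ∷ x) (b ∷ y) = cong₂ _∷_ (m+n∸m≡n a b) (⊕-⊖-cancelˡ x y)

⊕-cancelˡ : ∀ {d} (x : Pt d) {y z : Pt d} → x ⊕ y ≡ x ⊕ z → y ≡ z
⊕-cancelˡ x {y} {z} e =
  trans (sym (⊕-⊖-cancelˡ x y)) (trans (cong (_⊖ x) e) (⊕-⊖-cancelˡ x z))

⊕≡⇒𝟎 : ∀ {d} {x y : Pt d} → x ⊕ y ≡ x → y ≡ 𝟎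
⊕≡⇒𝟎 {x = x} e = ⊕-cancelˡ x (trans e (sym (⊕-identityʳ x)))

⊕≼⇒𝟎 : ∀ {d} {x y : Pt d} → (x ⊕ y) ≼ x → y ≡ 𝟎
⊕≼⇒𝟎 {x = x} {y} le = ⊕≡⇒𝟎 (≼-antisym le (x≼x⊕y x y))

⊖≡𝟎⇒≡ : ∀ {d} {x y : Pt d} → x ≼ y → y ⊖ x ≡ 𝟎 → x ≡ y
⊖≡𝟎⇒≡ {x = x} {y} x≼y e = begin
  x              ≡⟨ sym (⊕-identityʳ x) ⟩
  x ⊕ 𝟎          ≡⟨ cong (x ⊕_) (sym e) ⟩
  x ⊕ (y ⊖ x)    ≡⟨ ⊕-⊖-cancel x≼y ⟩
  y              ∎
  where open ≡-Reasoning

half≼double : ∀ {d} (h : Pt d) → h ≼ double h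
half≼double h = subst (h ≼_) (⊕-self h) (x≼x⊕y h h)

double⊖half : ∀ {d} (h : Pt d) → double h ⊖ h ≡ h
double⊖half h = trans (cong (_⊖ h) (sym (⊕-self h))) (⊕-⊖-cancelˡ h h)

reflect-shift : ∀ {d} (h s : Pt d) → (h ⊕ s) ≼ double h → (double h ⊖ (h ⊕ s)) ⊕ s ≡ h
reflect-shift h s le = ⊕-cancelˡ h (begin
  h ⊕ (r ⊕ s)        ≡⟨ cong (h ⊕_) (⊕-comm r s) ⟩
  h ⊕ (s ⊕ r)        ≡⟨ sym (⊕-assoc h s r) ⟩
  (h ⊕ s) ⊕ r        ≡⟨ ⊕-⊖-cancel le ⟩
  double h           ≡⟨ sym (⊕-self h) ⟩
  h ⊕ h              ∎)
  where
  open ≡-Reasoning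
  r = double h ⊖ (h ⊕ s)

reflect-below : ∀ {d} (x s : Pt d) → double (x ⊕ s) ⊖ x ≡ (x ⊕ s) ⊕ s
reflect-below x s = begin
  double y ⊖ x          ≡⟨ cong (_⊖ x) (sym (⊕-self y)) ⟩
  ((x ⊕ s) ⊕ y) ⊖ x     ≡⟨ cong (_⊖ x) (⊕-assoc x s y) ⟩
  (x ⊕ (s ⊕ y)) ⊖ x     ≡⟨ ⊕-⊖-cancelˡ x (s ⊕ y) ⟩
  s ⊕ y                 ≡⟨ ⊕-comm s y ⟩
  y ⊕ s                 ∎
  where
  open ≡-Reasoning
  y = x ⊕ s

-- The size x⁽¹⁾ + ⋯ + x⁽ᵈ⁾ strictly increases along ≺; it measures climbing.
size : ∀ {d} → Pt d → ℕ
size = Vec.sum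

size-mono : ∀ {d} {x y : Pt d} → x ≼ y → size x ≤ size y
size-mono []       = z≤n
size-mono (p ∷ ps) = +-mono-≤ p (size-mono ps)

size-strict : ∀ {d} {x y : Pt d} → x ≼ y → x ≢ y → size x < size y
size-strict [] x≢y = ⊥-elim (x≢y refl)
size-strict {x = a ∷ x} (p ∷ ps) x≢y with m≤n⇒m<n∨m≡n p
... | inj₁ a<b  = +-mono-<-≤ a<b (size-mono ps)
... | inj₂ refl = +-monoʳ-< a (size-strict ps (λ e → x≢y (cong (a ∷_) e)))

∈⇒size≤ : ∀ {d} {z : Pt d} {zs} → z ∈ zs → size z ≤ sum (List.map size zs)
∈⇒size≤ (here refl)  = m≤m+n _ _
∈⇒size≤ (there z∈zs) = ≤-trans (∈⇒size≤ z∈zs) (m≤n+m _ _)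

even⇒twice-half : ∀ n → parity n ≡ 0ℙ → 2 * ⌊ n /2⌋ ≡ n
even⇒twice-half zero          _    = refl
even⇒twice-half (suc zero)    ()
even⇒twice-half (suc (suc n)) even =
  cong suc (trans (+-suc ⌊ n /2⌋ _) (cong suc (even⇒twice-half n even)))

odd-factors : ∀ p q → p ℙ.* q ≡ 1ℙ → p ≡ 1ℙ × q ≡ 1ℙ
odd-factors 1ℙ 1ℙ _ = refl , refl

odd-prodSuc⇒double : ∀ {d} (f : Pt d) → parity (prodSuc f) ≡ 1ℙ → f ≡ double (map ⌊_/2⌋ f)
odd-prodSuc⇒double []      _   = refl
odd-prodSuc⇒double (a ∷ f) odd
  with odd-factors (parity (suc a)) (parity (prodSuc f))
         (trans (sym (*-homo-* (suc a) (prodSuc f))) odd)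
... | odd-head , odd-tail =
  cong₂ _∷_ (sym (even⇒twice-half a (trans (sym (suc-homo-⁻¹ a)) (cong _⁻¹ odd-head))))
            (odd-prodSuc⇒double f odd-tail)

-- ∏ᵢ (f⁽ⁱ⁾ + 1) ≥ 1, so 2g − 1 = ∏ᵢ (f⁽ⁱ⁾ + 1) cannot hold with g = 0.
prodSuc-positive : ∀ {d} (f : Pt d) → 1 ≤ prodSuc f
prodSuc-positive []      = s≤s z≤n
prodSuc-positive (a ∷ f) = ≤-trans (prodSuc-positive f) (m≤m+n _ _)

pred-double⇒suc : ∀ g P → 1 ≤ P → 2 * g ∸ 1 ≡ P → suc P ≡ 2 * g
pred-double⇒suc g P 1≤P e = begin
  suc P            ≡⟨ +-comm 1 P ⟩
  P + 1            ≡⟨ cong (_+ 1) (sym e) ⟩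
  2 * g ∸ 1 + 1    ≡⟨ m∸n+n≡m (≤-trans 1≤P (subst (_≤ 2 * g) e (m∸n≤m (2 * g) 1))) ⟩
  2 * g            ∎
  where open ≡-Reasoning

suc≡double⇒odd : ∀ g P → suc P ≡ 2 * g → parity P ≡ 1ℙ
suc≡double⇒odd g P e =
  trans (sym (suc-homo-⁻¹ P)) (cong _⁻¹ (trans (cong parity e) (*-homo-* 2 g)))

sumUpTo : ℕ → (ℕ → ℕ) → ℕ
sumUpTo zero    G = G 0
sumUpTo (suc a) G = G 0 + sumUpTo a (λ i → G (suc i))

sumUpTo-cong : ∀ a {G K : ℕ → ℕ} → (∀ i → i ≤ a → G i ≡ K i) → sumUpTo a G ≡ sumUpTo a K
sumUpTo-cong zero    eq = eq 0 z≤n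
sumUpTo-cong (suc a) eq = cong₂ _+_ (eq 0 z≤n) (sumUpTo-cong a (λ i i≤a → eq (suc i) (s≤s i≤a)))

sumUpTo-mono : ∀ a {G K : ℕ → ℕ} → (∀ i → i ≤ a → G i ≤ K i) → sumUpTo a G ≤ sumUpTo a K
sumUpTo-mono zero    le = le 0 z≤n
sumUpTo-mono (suc a) le = +-mono-≤ (le 0 z≤n) (sumUpTo-mono a (λ i i≤a → le (suc i) (s≤s i≤a)))

sumUpTo-strict : ∀ a {G K : ℕ → ℕ} → (∀ i → i ≤ a → G i ≤ K i) →
                 ∀ j → j ≤ a → G j < K j → sumUpTo a G < sumUpTo a K
sumUpTo-strict zero    le zero    _         lt = lt
sumUpTo-strict (suc a) le zero    _         lt =
  +-mono-<-≤ lt (sumUpTo-mono a (λ i i≤a → le (suc i) (s≤s i≤a)))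
sumUpTo-strict (suc a) le (suc j) (s≤s j≤a) lt =
  +-mono-≤-< (le 0 z≤n) (sumUpTo-strict a (λ i i≤a → le (suc i) (s≤s i≤a)) j j≤a lt)

sumUpTo-+ : ∀ a (G K : ℕ → ℕ) → sumUpTo a (λ i → G i + K i) ≡ sumUpTo a G + sumUpTo a K
sumUpTo-+ zero    G K = refl
sumUpTo-+ (suc a) G K = begin
  (G 0 + K 0) + sumUpTo a (λ i → G (suc i) + K (suc i))
    ≡⟨ cong ((G 0 + K 0) +_) (sumUpTo-+ a (λ i → G (suc i)) (λ i → K (suc i))) ⟩
  (G 0 + K 0) + (sumUpTo a (λ i → G (suc i)) + sumUpTo a (λ i → K (suc i)))
    ≡⟨ interchange (G 0) (K 0) _ _ ⟩
  (G 0 + sumUpTo a (λ i → G (suc i))) + (K 0 + sumUpTo a (λ i → K (suc i)))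
    ∎
  where open ≡-Reasoning

sumUpTo-const : ∀ a c → sumUpTo a (λ _ → c) ≡ suc a * c
sumUpTo-const zero    c = sym (+-identityʳ c)
sumUpTo-const (suc a) c = cong (c +_) (sumUpTo-const a c)

sumUpTo-zero : ∀ a {G : ℕ → ℕ} → (∀ i → i ≤ a → G i ≡ 0) → sumUpTo a G ≡ 0
sumUpTo-zero a vanish = trans (sumUpTo-cong a vanish) (trans (sumUpTo-const a 0) (*-zeroʳ (suc a)))

sumUpTo-single : ∀ a b {G : ℕ → ℕ} → b ≤ a → (∀ i → i ≤ a → i ≢ b → G i ≡ 0) → sumUpTo a G ≡ G b
sumUpTo-single zero    zero    z≤n       _      = refl
sumUpTo-single (suc a) zero    {G} z≤n   vanish =
  trans (cong (G 0 +_) (sumUpTo-zero a (λ i i≤a → vanish (suc i) (s≤s i≤a) (λ ())))) (+-identityʳ _)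
sumUpTo-single (suc a) (suc b) {G} (s≤s b≤a) vanish =
  trans (cong (_+ sumUpTo a (λ i → G (suc i))) (vanish 0 z≤n (λ ())))
        (sumUpTo-single a b b≤a (λ i i≤a i≢b → vanish (suc i) (s≤s i≤a) (λ e → i≢b (suc-injective e))))

sumUpTo-snoc : ∀ a (G : ℕ → ℕ) → sumUpTo (suc a) G ≡ sumUpTo a G + G (suc a)
sumUpTo-snoc zero    G = refl
sumUpTo-snoc (suc a) G = trans (cong (G 0 +_) (sumUpTo-snoc a (λ i → G (suc i)))) (sym (+-assoc (G 0) _ _))

sumUpTo-reverse : ∀ a (G : ℕ → ℕ) → sumUpTo a (λ i → G (a ∸ i)) ≡ sumUpTo a G
sumUpTo-reverse zero    G = refl
sumUpTo-reverse (suc a) G = begin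
  G (suc a) + sumUpTo a (λ i → G (a ∸ i))  ≡⟨ cong (G (suc a) +_) (sumUpTo-reverse a G) ⟩
  G (suc a) + sumUpTo a G                  ≡⟨ +-comm (G (suc a)) _ ⟩
  sumUpTo a G + G (suc a)                  ≡⟨ sym (sumUpTo-snoc a G) ⟩
  sumUpTo (suc a) G                        ∎
  where open ≡-Reasoning

sumBox : ∀ {d} → Pt d → (Pt d → ℕ) → ℕ
sumBox []      φ = φ []
sumBox (a ∷ f) φ = sumUpTo a (λ i → sumBox f (λ x → φ (i ∷ x)))

sumBox-mono : ∀ {d} (f : Pt d) {φ ψ : Pt d → ℕ} → (∀ x → x ≼ f → φ x ≤ ψ x) → sumBox f φ ≤ sumBox f ψ
sumBox-mono []      le = le [] []
sumBox-mono (a ∷ f) le = sumUpTo-mono a (λ i i≤a → sumBox-mono f (λ x x≼f → le (i ∷ x) (i≤a ∷ x≼f)))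

sumBox-strict : ∀ {d} (f : Pt d) {φ ψ : Pt d → ℕ} → (∀ x → x ≼ f → φ x ≤ ψ x) →
                ∀ y → y ≼ f → φ y < ψ y → sumBox f φ < sumBox f ψ
sumBox-strict []      le []      []            lt = lt
sumBox-strict (a ∷ f) le (j ∷ y) (j≤a ∷ y≼f) lt =
  sumUpTo-strict a (λ i i≤a → sumBox-mono f (λ x x≼f → le (i ∷ x) (i≤a ∷ x≼f)))
    j j≤a (sumBox-strict f (λ x x≼f → le (j ∷ x) (j≤a ∷ x≼f)) y y≼f lt)

sumBox-+ : ∀ {d} (f : Pt d) (φ ψ : Pt d → ℕ) → sumBox f (λ x → φ x + ψ x) ≡ sumBox f φ + sumBox f ψ
sumBox-+ []      φ ψ = refl
sumBox-+ (a ∷ f) φ ψ =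
  trans (sumUpTo-cong a (λ i _ → sumBox-+ f (λ x → φ (i ∷ x)) (λ x → ψ (i ∷ x)))) (sumUpTo-+ a _ _)

sumBox-zero : ∀ {d} (f : Pt d) {φ : Pt d → ℕ} → (∀ x → x ≼ f → φ x ≡ 0) → sumBox f φ ≡ 0
sumBox-zero []      vanish = vanish [] []
sumBox-zero (a ∷ f) vanish =
  sumUpTo-zero a (λ i i≤a → sumBox-zero f (λ x x≼f → vanish (i ∷ x) (i≤a ∷ x≼f)))

sumBox-single : ∀ {d} (f h : Pt d) {φ : Pt d → ℕ} → h ≼ f →
                (∀ x → x ≼ f → x ≢ h → φ x ≡ 0) → sumBox f φ ≡ φ h
sumBox-single []      []      []            _      = refl
sumBox-single (a ∷ f) (b ∷ h) (b≤a ∷ h≼f) vanish =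
  trans (sumUpTo-single a b b≤a (λ i i≤a i≢b →
           sumBox-zero f (λ x x≼f → vanish (i ∷ x) (i≤a ∷ x≼f) (λ e → i≢b (∷-injectiveˡ e)))))
        (sumBox-single f h h≼f (λ x x≼f x≢h → vanish (b ∷ x) (b≤a ∷ x≼f) (λ e → x≢h (∷-injectiveʳ e))))

sumBox-reflect : ∀ {d} (f : Pt d) (φ : Pt d → ℕ) → sumBox f (λ x → φ (f ⊖ x)) ≡ sumBox f φ
sumBox-reflect []      φ = refl
sumBox-reflect (a ∷ f) φ =
  trans (sumUpTo-cong a (λ i _ → sumBox-reflect f (λ x → φ ((a ∸ i) ∷ x))))
        (sumUpTo-reverse a (λ j → sumBox f (λ x → φ (j ∷ x))))

sumBox-one : ∀ {d} (f : Pt d) → sumBox f (λ _ → 1) ≡ prodSuc f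
sumBox-one []      = refl
sumBox-one (a ∷ f) = trans (sumUpTo-cong a (λ i _ → sumBox-one f)) (sumUpTo-const a (prodSuc f))

𝟙 : ∀ {P : Set} → Dec P → ℕ
𝟙 (yes _) = 1
𝟙 (no _)  = 0

𝟙-yes : ∀ {P : Set} (q : Dec P) → P → 𝟙 q ≡ 1
𝟙-yes (yes _) _ = refl
𝟙-yes (no ¬p) p = ⊥-elim (¬p p)

𝟙-no : ∀ {P : Set} (q : Dec P) → ¬ P → 𝟙 q ≡ 0
𝟙-no (yes p) ¬p = ⊥-elim (¬p p)
𝟙-no (no _)  _  = refl

δ : ∀ {d} → Pt d → Pt d → ℕ
δ h x = 𝟙 (x ≟ₚ h)

sumBox-δ : ∀ {d} (f h : Pt d) → sumBox f (δ h) ≡ 𝟙 (h ≼? f)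
sumBox-δ f h with h ≼? f
... | yes h≼f = trans (sumBox-single f h h≼f (λ x _ x≢h → 𝟙-no (x ≟ₚ h) x≢h)) (𝟙-yes (h ≟ₚ h) refl)
... | no h⋠f  = sumBox-zero f (λ x x≼f → 𝟙-no (x ≟ₚ h) (λ e → h⋠f (subst (_≼ f) e x≼f)))

mult : ∀ {d} → Pt d → List (Pt d) → ℕ
mult x []       = 0
mult x (h ∷ hs) = δ h x + mult x hs

mult-∈ : ∀ {d} {x : Pt d} {hs} → x ∈ hs → 1 ≤ mult x hs
mult-∈ {x = x} (here refl) = ≤-trans (≤-reflexive (sym (𝟙-yes (x ≟ₚ x) refl))) (m≤m+n _ _)
mult-∈ (there x∈hs)        = ≤-trans (mult-∈ x∈hs) (m≤n+m _ _)

mult-∉ : ∀ {d} {x : Pt d} {hs} → x ∉ hs → mult x hs ≡ 0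
mult-∉ {x = x} {[]}     _    = refl
mult-∉ {x = x} {h ∷ hs} x∉hs =
  cong₂ _+_ (𝟙-no (x ≟ₚ h) (λ e → x∉hs (here e))) (mult-∉ (λ m → x∉hs (there m)))

mult-unique : ∀ {d} (x : Pt d) {hs} → Unique hs → mult x hs ≤ 1
mult-unique x {[]}     _                = z≤n
mult-unique x {h ∷ hs} (h∉hs ∷ unique) with x ≟ₚ h
... | yes refl = ≤-reflexive (cong suc (mult-∉ (All¬⇒¬Any h∉hs)))
... | no _     = mult-unique x unique

length-filter-∷ : ∀ {d} (f h : Pt d) hs →
  length (filter (_≼? f) (h ∷ hs)) ≡ 𝟙 (h ≼? f) + length (filter (_≼? f) hs)
length-filter-∷ f h hs with h ≼? f
... | yes _ = refl
... | no _  = refl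

sumBox-mult : ∀ {d} (f : Pt d) hs → sumBox f (λ x → mult x hs) ≡ length (filter (_≼? f) hs)
sumBox-mult f []       = sumBox-zero f (λ _ _ → refl)
sumBox-mult f (h ∷ hs) = begin
  sumBox f (λ x → δ h x + mult x hs)             ≡⟨ sumBox-+ f (δ h) (λ x → mult x hs) ⟩
  sumBox f (δ h) + sumBox f (λ x → mult x hs)    ≡⟨ cong₂ _+_ (sumBox-δ f h) (sumBox-mult f hs) ⟩
  𝟙 (h ≼? f) + length (filter (_≼? f) hs)        ≡⟨ sym (length-filter-∷ f h hs) ⟩
  length (filter (_≼? f) (h ∷ hs))               ∎
  where open ≡-Reasoning

HolesReflectAbout : ∀ {d} → Pred (Pt d) 0ℓ → Pt d → Set
HolesReflectAbout S h = ∀ x → H S x → x ≼ double h × (x ≢ h → S (double h ⊖ x))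

greatest-hole⇒Frobenius : ∀ {d} {S : Pred (Pt d) 0ℓ} {f : Pt d} →
  H S f → (∀ x → H S x → x ≼ f) → IsFrobenius S f
greatest-hole⇒Frobenius hf below =
  (hf , λ x hx f≼x → ≼-antisym (below x hx) f≼x) ,
  λ f′ (hf′ , maximal) → sym (maximal _ hf (below f′ hf′))

module GNS {d : ℕ} (S : Pred (Pt d) 0ℓ) (S-monoid : IsSubmonoid S)
           (hs : List (Pt d)) (enumerates : EnumeratesHoles S hs) where

  S-zero : S 𝟎
  S-zero = proj₁ S-monoid

  S-add : ∀ x y → S x → S y → S (x ⊕ y)
  S-add = proj₂ S-monoid

  unique : Unique hs
  unique = proj₁ enumerates

  hole∈hs : ∀ {x} → H S x → x ∈ hs
  hole∈hs {x} hx with proj₁ (proj₂ enumerates) x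
  ... | inj₁ sx   = ⊥-elim (hx sx)
  ... | inj₂ x∈hs = x∈hs

  ∈hs⇒hole : ∀ {x} → x ∈ hs → H S x
  ∈hs⇒hole {x} = proj₂ (proj₂ enumerates) x

  -- Membership in S is decidable (its complement is listed), hence ¬¬-stable.
  S? : ∀ x → Dec (S x)
  S? x with proj₁ (proj₂ enumerates) x
  ... | inj₁ sx   = yes sx
  ... | inj₂ x∈hs = no (∈hs⇒hole x∈hs)

  S-stable : ∀ {x} → ¬ H S x → S x
  S-stable {x} = decidable-stable (S? x)

  -- If 2h is a hole then so is h, since h ∈ S would give 2h = h + h ∈ S.
  half-hole : ∀ {h} → H S (double h) → H S h
  half-hole {h} hf sh = hf (subst S (⊕-self h) (S-add h h sh sh))

  genus : ℕ
  genus = length hs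

  c : Pt d → ℕ
  c x = mult x hs

  c-hole : ∀ {x} → H S x → 1 ≤ c x
  c-hole hx = mult-∈ (hole∈hs hx)

  c-S : ∀ {x} → S x → c x ≡ 0
  c-S sx = mult-∉ (λ x∈hs → ∈hs⇒hole x∈hs sx)

  c≤1 : ∀ x → c x ≤ 1
  c≤1 x = mult-unique x unique

  holesBelow : Pt d → ℕ
  holesBelow f = length (filter (_≼? f) hs)

  holesBelow≤genus : ∀ f → holesBelow f ≤ genus
  holesBelow≤genus f = length-filter (_≼? f) hs

  pairCount : Pt d → Pt d → ℕ
  pairCount f x = c x + c (f ⊖ x)

  sum-pairCount : ∀ f → sumBox f (pairCount f) ≡ 2 * holesBelow f
  sum-pairCount f = begin
    sumBox f (pairCount f)                     ≡⟨ sumBox-+ f c (λ x → c (f ⊖ x)) ⟩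
    sumBox f c + sumBox f (λ x → c (f ⊖ x))    ≡⟨ cong (sumBox f c +_) (sumBox-reflect f c) ⟩
    sumBox f c + sumBox f c                    ≡⟨ cong (λ n → n + n) (sumBox-mult f hs) ⟩
    holesBelow f + holesBelow f                ≡⟨ cong (holesBelow f +_) (sym (+-identityʳ (holesBelow f))) ⟩
    2 * holesBelow f                           ∎
    where open ≡-Reasoning

  centreWeight : Pt d → Pt d → ℕ
  centreWeight h x = suc (δ h x)

  sum-centreWeight : ∀ h → sumBox (double h) (centreWeight h) ≡ suc (prodSuc (double h))
  sum-centreWeight h = begin
    sumBox f (λ x → 1 + δ h x)             ≡⟨ sumBox-+ f (λ _ → 1) (δ h) ⟩
    sumBox f (λ _ → 1) + sumBox f (δ h)    ≡⟨ cong₂ _+_ (sumBox-one f) (sumBox-δ f h) ⟩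
    prodSuc f + 𝟙 (h ≼? f)                 ≡⟨ cong (prodSuc f +_) (𝟙-yes (h ≼? f) (half≼double h)) ⟩
    prodSuc f + 1                          ≡⟨ +-comm (prodSuc f) 1 ⟩
    suc (prodSuc f)                        ∎
    where
    open ≡-Reasoning
    f = double h

  -- For a hole f = 2h, x and f − x are never both in S, and the centre h = f − h
  -- is itself a hole.
  centreWeight≤pairCount : ∀ {h} → H S (double h) → ∀ x → x ≼ double h →
                           centreWeight h x ≤ pairCount (double h) x
  centreWeight≤pairCount {h} hf x x≼f with x ≟ₚ h
  ... | yes refl = +-mono-≤ (c-hole (half-hole hf))
                            (subst (λ y → 1 ≤ c y) (sym (double⊖half x)) (c-hole (half-hole hf)))
  ... | no _ with S? x | S? (double h ⊖ x)
  ...   | no hx  | _        = ≤-trans (c-hole hx) (m≤m+n _ _)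
  ...   | yes _  | no hx′   = ≤-trans (c-hole hx′) (m≤n+m _ _)
  ...   | yes sx | yes sx′  = ⊥-elim (hf (subst S (⊕-⊖-cancel x≼f) (S-add _ _ sx sx′)))

  doubled-hole-bound : ∀ {h} → H S (double h) → suc (prodSuc (double h)) ≤ 2 * holesBelow (double h)
  doubled-hole-bound {h} hf =
    subst₂ _≤_ (sum-centreWeight h) (sum-pairCount (double h))
      (sumBox-mono (double h) (centreWeight≤pairCount hf))

  doubled-hole-bound-strict : ∀ {h x} → H S (double h) → x ≼ double h → x ≢ h →
    H S x → H S (double h ⊖ x) → suc (prodSuc (double h)) < 2 * holesBelow (double h)
  doubled-hole-bound-strict {h} {x} hf x≼f x≢h hx hx′ =
    subst₂ _<_ (sum-centreWeight h) (sum-pairCount (double h))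
      (sumBox-strict (double h) (centreWeight≤pairCount hf) x x≼f two-holes)
    where
    two-holes : centreWeight h x < pairCount (double h) x
    two-holes = subst (λ n → suc n < pairCount (double h) x) (sym (𝟙-no (x ≟ₚ h) x≢h))
                      (+-mono-≤ (c-hole hx) (c-hole hx′))

  extremal⇒reflect : ∀ {h} → H S (double h) → suc (prodSuc (double h)) ≡ 2 * genus →
                     HolesReflectAbout S h
  extremal⇒reflect {h} hf E x hx = below x hx , λ x≢h → S-stable λ hx′ →
    <-irrefl E (<-≤-trans (doubled-hole-bound-strict hf (below x hx) x≢h hx hx′)
                          (*-monoʳ-≤ 2 (holesBelow≤genus (double h))))
    where
    below : ∀ z → H S z → z ≼ double h
    below z hz with z ≼? double h
    ... | yes z≼f = z≼f
    ... | no z⋠f  = ⊥-elim (<-irrefl E (≤-<-trans (doubled-hole-bound hf)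
                      (*-monoʳ-< 2 (filter-notAll (_≼? double h) hs (lose (hole∈hs hz) z⋠f)))))

  pairCount≤centreWeight : ∀ {h} → HolesReflectAbout S h → ∀ x → pairCount (double h) x ≤ centreWeight h x
  pairCount≤centreWeight {h} reflect x with x ≟ₚ h
  ... | yes refl = +-mono-≤ (c≤1 x) (c≤1 _)
  ... | no x≢h with S? x
  ...   | yes sx = +-mono-≤ (≤-reflexive (c-S sx)) (c≤1 _)
  ...   | no hx  = +-mono-≤ (c≤1 x) (≤-reflexive (c-S (proj₂ (reflect x hx) x≢h)))

  reflect-bound : ∀ {h} → HolesReflectAbout S h → 2 * genus ≤ suc (prodSuc (double h))
  reflect-bound {h} reflect =
    subst₂ _≤_ (trans (sum-pairCount (double h)) (cong (2 *_) all-below)) (sum-centreWeight h)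
      (sumBox-mono (double h) (λ x _ → pairCount≤centreWeight reflect x))
    where
    all-below : holesBelow (double h) ≡ genus
    all-below = cong length (filter-all (_≼? double h)
                  (tabulate λ z∈hs → proj₁ (reflect _ (∈hs⇒hole z∈hs))))

  reflect⇒genus : ∀ {h} → H S (double h) → HolesReflectAbout S h → suc (prodSuc (double h)) ≡ 2 * genus
  reflect⇒genus {h} hf reflect =
    ≤-antisym (≤-trans (doubled-hole-bound hf) (*-monoʳ-≤ 2 (holesBelow≤genus (double h))))
              (reflect-bound reflect)

  arithmetic⇒reflect : ∀ f → H S f → 2 * genus ∸ 1 ≡ prodSuc f →
                       ∃ λ h → f ≡ double h × HolesReflectAbout S h
  arithmetic⇒reflect f hf eq =
    h , f≡2h , extremal⇒reflect (subst (H S) f≡2h hf) (subst (λ y → suc (prodSuc y) ≡ 2 * genus) f≡2h E)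
    where
    E : suc (prodSuc f) ≡ 2 * genus
    E = pred-double⇒suc genus (prodSuc f) (prodSuc-positive f) eq
    h : Pt d
    h = map ⌊_/2⌋ f
    f≡2h : f ≡ double h
    f≡2h = odd-prodSuc⇒double f (suc≡double⇒odd genus (prodSuc f) E)

  reflect⇒PF : ∀ {h} → H S (double h) → HolesReflectAbout S h →
               ∀ x → PF S x ⇔ (x ≡ double h ⊎ x ≡ h)
  reflect⇒PF {h} hf reflect x = mk⇔ only members
    where
    -- f + s (s ≠ 0) is not below f, so it is not a hole.
    f-PF : PF S (double h)
    f-PF = hf , λ s _ s≢𝟎 → S-stable λ hfs → s≢𝟎 (⊕≼⇒𝟎 (proj₁ (reflect _ hfs)))
    -- if h + s were a hole, h = (2h − (h + s)) + s would be a sum of elements of S.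
    h-PF : PF S h
    h-PF = half-hole hf , λ s ss s≢𝟎 → S-stable λ hhs →
      half-hole hf (subst S (reflect-shift h s (proj₁ (reflect _ hhs)))
        (S-add _ _ (proj₂ (reflect _ hhs) (λ e → s≢𝟎 (⊕≡⇒𝟎 e))) ss))
    members : ∀ {y} → y ≡ double h ⊎ y ≡ h → PF S y
    members (inj₁ e) = subst (PF S) (sym e) f-PF
    members (inj₂ e) = subst (PF S) (sym e) h-PF
    -- any other pseudo-Frobenius x would give 2h = x + (2h − x) ∈ S.
    only : PF S x → x ≡ double h ⊎ x ≡ h
    only (hx , closed) with x ≟ₚ h | x ≟ₚ double h
    ... | yes x≡h | _       = inj₂ x≡h
    ... | no _    | yes x≡f = inj₁ x≡f
    ... | no x≢h  | no x≢f  = ⊥-elim (hf (subst S (⊕-⊖-cancel x≼f)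
            (closed (double h ⊖ x) (proj₂ (reflect x hx) x≢h) (λ e → x≢f (⊖≡𝟎⇒≡ x≼f e)))))
      where
      x≼f : x ≼ double h
      x≼f = proj₁ (reflect x hx)

  StepsTo : Pt d → Pt d → Set
  StepsTo y z = y ≼ z × z ≢ y × S (z ⊖ y)

  StepsTo? : ∀ y z → Dec (StepsTo y z)
  StepsTo? y z = (y ≼? z) ×-dec (¬? (z ≟ₚ y) ×-dec S? (z ⊖ y))

  stuck⇒PF : ∀ {y} → H S y → ¬ Any (StepsTo y) hs → PF S y
  stuck⇒PF {y} hy stuck = hy , λ s ss s≢𝟎 → S-stable λ hys →
    stuck (lose (hole∈hs hys)
      (x≼x⊕y y s , (λ e → s≢𝟎 (⊕≡⇒𝟎 e)) , subst S (sym (⊕-⊖-cancelˡ y s)) ss))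

  -- Climbing: stepping up from a hole y ends, since the size of holes is bounded,
  -- at a pseudo-Frobenius element y + t with t ∈ S.
  climb : ∀ y → H S y → Acc _<_ (sum (List.map size hs) ∸ size y) →
          ∃ λ t → S t × PF S (y ⊕ t)
  climb y hy (acc smaller) with any? (StepsTo? y) hs
  ... | no stuck = 𝟎 , S-zero , subst (PF S) (sym (⊕-identityʳ y)) (stuck⇒PF hy stuck)
  ... | yes step with find step
  ...   | z , z∈hs , (y≼z , z≢y , sz)
        with climb z (∈hs⇒hole z∈hs)
               (smaller (∸-monoʳ-< (size-strict y≼z (λ e → z≢y (sym e))) (∈⇒size≤ z∈hs)))
  ...     | t , st , pf = (z ⊖ y) ⊕ t , S-add _ _ sz st , subst (PF S) z⊕t≡ pf
    where
    z⊕t≡ : z ⊕ t ≡ y ⊕ ((z ⊖ y) ⊕ t)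
    z⊕t≡ = trans (cong (_⊕ t) (sym (⊕-⊖-cancel y≼z))) (⊕-assoc y (z ⊖ y) t)

  below-PF : ∀ y → H S y → ∃ λ t → S t × PF S (y ⊕ t)
  below-PF y hy = climb y hy (<-wellFounded _)

  -- If PF(S) = {2h, h}, the holes reflect about h: climb from a hole x to x + t ∈ PF(S).
  pseudoSymmetric⇒reflect : ∀ {h} → (∀ x → PF S x ⇔ (x ≡ double h ⊎ x ≡ h)) →
                            HolesReflectAbout S h
  pseudoSymmetric⇒reflect {h} pf⇔ x hx with below-PF x hx
  ... | t , st , pf with Equivalence.to (pf⇔ (x ⊕ t)) pf
  ...   | inj₁ x⊕t≡f =
          subst (x ≼_) x⊕t≡f (x≼x⊕y x t) ,
          λ _ → subst S (trans (sym (⊕-⊖-cancelˡ x t)) (cong (_⊖ x) x⊕t≡f)) st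
  ...   | inj₂ x⊕t≡h =
          ≼-trans (subst (x ≼_) x⊕t≡h (x≼x⊕y x t)) (half≼double h) , reflected
    where
    t≢𝟎 : x ≢ h → t ≢ 𝟎
    t≢𝟎 x≢h t≡𝟎 = x≢h (trans (sym (⊕-identityʳ x)) (trans (cong (x ⊕_) (sym t≡𝟎)) x⊕t≡h))
    -- 2h − x = h + t, which lies in S because h is pseudo-Frobenius.
    reflected : x ≢ h → S (double h ⊖ x)
    reflected x≢h = subst S (begin
      h ⊕ t                  ≡⟨ cong (_⊕ t) (sym x⊕t≡h) ⟩
      (x ⊕ t) ⊕ t            ≡⟨ sym (reflect-below x t) ⟩
      double (x ⊕ t) ⊖ x     ≡⟨ cong (λ y → double y ⊖ x) x⊕t≡h ⟩
      double h ⊖ x           ∎)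
      (proj₂ (Equivalence.from (pf⇔ h) (inj₂ refl)) t st (t≢𝟎 x≢h))
      where open ≡-Reasoning

mainTheorem7 : (d : ℕ) (S : Pred (Pt d) 0ℓ) (g : ℕ) → IsGNS S → HasGenus S g →
    (IsPseudoSymmetric S ⇔ (∃ λ (f : Pt d) → H S f × 2 * g ∸ 1 ≡ prodSuc f))
    × (∀ (f : Pt d) → H S f → 2 * g ∸ 1 ≡ prodSuc f → IsFrobenius S f)
mainTheorem7 d S .(length hs) (S-monoid , _) (hs , enumerates , refl) =
  mk⇔ pseudoSymmetric⇒condition condition⇒pseudoSymmetric , condition⇒Frobenius
  where
  open GNS S S-monoid hs enumerates

  pseudoSymmetric⇒condition : IsPseudoSymmetric S → ∃ λ f → H S f × 2 * genus ∸ 1 ≡ prodSuc f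
  pseudoSymmetric⇒condition (h , pf⇔) =
    double h , hf , cong (_∸ 1) (sym (reflect⇒genus hf (pseudoSymmetric⇒reflect pf⇔)))
    where
    hf : H S (double h)
    hf = proj₁ (Equivalence.from (pf⇔ (double h)) (inj₁ refl))

  condition⇒pseudoSymmetric : (∃ λ f → H S f × 2 * genus ∸ 1 ≡ prodSuc f) → IsPseudoSymmetric S
  condition⇒pseudoSymmetric (f , hf , eq) with arithmetic⇒reflect f hf eq
  ... | h , refl , reflect = h , reflect⇒PF hf reflect

  condition⇒Frobenius : ∀ f → H S f → 2 * genus ∸ 1 ≡ prodSuc f → IsFrobenius S f
  condition⇒Frobenius f hf eq with arithmetic⇒reflect f hf eq
  ... | h , refl , reflect = greatest-hole⇒Frobenius hf (λ x hx → proj₁ (reflect x hx))
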